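{- Let $A_1,\dots,A_n$ be finite subsets of the sort $\Omega$ of $M_n$. Then $\operatorname{acl}(\operatorname{acl}(A_1),\dots,\operatorname{acl}(A_n))=\operatorname{acl}\left(\bigcup_{i=1}^nA_i\right)$.
   Context: Let $n\geq 2$ and $\Omega$ a countably infinite set; $[X]^m$ is the set of $m$-subsets of $X$. $\beta^\ast_{n,n-1}:\mathbb{F}_2^{[\Omega]^{n-1}}\to\mathbb{F}_2^{[\Omega]^n}$, $(\beta^\ast_{n,n-1}f)(\omega)=\sum_{x\in[\omega]^{n-1}}f(x)$. $M_n$ is the countable $\aleph_0$-categorical multisorted structure with sorts $\Omega$, $[\Omega]^n$, $[\Omega]^n\times\mathbb{F}_2$ whose automorphism group is $G=\operatorname{Im}\beta^\ast_{n,n-1}\rtimes\operatorname{Sym}(\Omega)$ (e.g. with the $G$-orbits on finite tuples as basic relations), where $g\sigma$ acts on $\Omega$ and $[\Omega]^n$ via $\sigma$ and by $(w,x)\mapsto(w^\sigma,x+g(w))$ on $[\Omega]^n\times\mathbb{F}_2$. For $X\subseteq M_n^{\mathrm{eq}}$, $\operatorname{acl}(X)$ is the union of the finite orbits in $M_n^{\mathrm{eq}}$ of the subgroup of $\operatorname{Aut}(M_n)$ fixing $X$ pointwise. -}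

module Defs where

open import Level using (Level; 0ℓ) renaming (suc to lsuc)
open import Data.Nat using (ℕ; zero; suc; pred)
open import Data.Bool using (Bool; true; false; _xor_)
open import Data.Fin using (Fin; zero; suc)
open import Data.Vec using (Vec; []; _∷_; lookup; map)
open import Data.Vec.Properties using (lookup-map)
open import Data.Vec.Membership.Propositional using (_∈_)
open import Data.List as List using (List; foldr; tabulate)
open import Data.List.Membership.Propositional renaming (_∈_ to _∈ₗ_)
open import Data.List.Relation.Unary.Any using (Any)
open import Data.Product using (Σ; ∃; _×_; _,_)
open import Function using (_∘_)
open import Function.Bundles using (_⤖_; Bijection)
open import Relation.Binary.PropositionalEquality using (_≡_; refl; trans; sym; cong)
open import Relation.Binary.Core using (Rel)
open import Relation.Binary.Structures using (IsEquivalence)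

-- Finite sets as vectors of pairwise distinct naturals (Ω = ℕ).

Distinct : {k : ℕ} → Vec ℕ k → Set
Distinct {k} v = (i j : Fin k) → lookup v i ≡ lookup v j → i ≡ j

SameSet : {k : ℕ} → Vec ℕ k → Vec ℕ k → Set
SameSet v w = (x : ℕ) → (x ∈ v → x ∈ w) × (x ∈ w → x ∈ v)

-- remove the i-th coordinate: the (k-1)-subsets of a k-set are exactly these
removeAt' : {A : Set} {k : ℕ} → Vec A k → Fin k → Vec A (pred k)
removeAt' (x ∷ xs) zero = xs
removeAt' (x ∷ y ∷ ys) (suc i) = x ∷ removeAt' (y ∷ ys) i

sumF₂ : {k : ℕ} → (Fin k → Bool) → Bool
sumF₂ g = foldr _xor_ false (tabulate g)

β* : (n : ℕ) → (Vec ℕ (pred n) → Bool) → Vec ℕ n → Bool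
β* n f w = sumF₂ (λ i → f (removeAt' w i))

-- The points of M_n (three sorts).

data Pt (n : ℕ) : Set where
  elt : ℕ → Pt n
  sub : (w : Vec ℕ n) → Distinct w → Pt n
  fib : (w : Vec ℕ n) → Distinct w → Bool → Pt n

data _≈P_ {n : ℕ} : Pt n → Pt n → Set where
  elt≈ : {x : ℕ} → elt x ≈P elt x
  sub≈ : {v w : Vec ℕ n} {dv : Distinct v} {dw : Distinct w} →
         SameSet v w → sub v dv ≈P sub w dw
  fib≈ : {v w : Vec ℕ n} {dv : Distinct v} {dw : Distinct w} {b : Bool} →
         SameSet v w → fib v dv b ≈P fib w dw b

_≈T_ : {n k : ℕ} → Vec (Pt n) k → Vec (Pt n) k → Set
_≈T_ {k = k} a b = (i : Fin k) → lookup a i ≈P lookup b i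

-- Automorphisms: elements gσ of Im β*_{n,n-1} ⋊ Sym(Ω), g = β* f.

record Aut (n : ℕ) : Set where
  field
    f    : Vec ℕ (pred n) → Bool
    f-wd : (v w : Vec ℕ (pred n)) → Distinct v → Distinct w →
           SameSet v w → f v ≡ f w
    σ    : ℕ ⤖ ℕ

open Aut

map-distinct : {k : ℕ} (s : ℕ ⤖ ℕ) (w : Vec ℕ k) → Distinct w →
               Distinct (map (Bijection.to s) w)
map-distinct s w d i j eq =
  d i j (Bijection.injective s
          (trans (sym (lookup-map i (Bijection.to s) w))
                 (trans eq (lookup-map j (Bijection.to s) w))))

actP : {n : ℕ} → Aut n → Pt n → Pt n
actP h (elt x) = elt (Bijection.to (σ h) x)
actP h (sub w d) = sub (map (Bijection.to (σ h)) w) (map-distinct (σ h) w d)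
actP {n} h (fib w d b) =
  fib (map (Bijection.to (σ h)) w) (map-distinct (σ h) w d) (b xor β* n (f h) w)

actT : {n k : ℕ} → Aut n → Vec (Pt n) k → Vec (Pt n) k
actT h = map (actP h)

-- M_n^eq: a sort is M^k / E for a 0-definable equivalence relation E on
-- M^k; since M_n is ℵ₀-categorical, 0-definable = Aut(M_n)-invariant.

record EqSort (n : ℕ) : Set₁ where
  field
    k       : ℕ
    E       : Rel (Vec (Pt n) k) 0ℓ
    isEquiv : IsEquivalence E
    resp    : {a a' b b' : Vec (Pt n) k} → a ≈T a' → b ≈T b' → E a b → E a' b'
    inv     : (h : Aut n) {a b : Vec (Pt n) k} → E a b → E (actT h a) (actT h b)

record Imag (n : ℕ) : Set₁ where
  field
    S : EqSort n
    a : Vec (Pt n) (EqSort.k S)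

Fixes : {n : ℕ} → Aut n → Imag n → Set
Fixes h e = EqSort.E (Imag.S e) (actT h (Imag.a e)) (Imag.a e)

FiniteOrbit : {n : ℕ} → (Aut n → Set₁) → Imag n → Set₁
FiniteOrbit {n} P e =
  Σ (List (Vec (Pt n) (EqSort.k (Imag.S e)))) λ L →
    (h : Aut n) → P h → Any (EqSort.E (Imag.S e) (actT h (Imag.a e))) L

acl : {n : ℕ} → (Imag n → Set₁) → Imag n → Set₁
acl {n} X = FiniteOrbit (λ h → (e : Imag n) → X e → Fixes h e)

aclΩ : {n : ℕ} → List ℕ → Imag n → Set₁
aclΩ A = FiniteOrbit (λ h → Level.Lift _ ((x : ℕ) → x ∈ₗ A → Bijection.to (σ h) x ≡ x))

⋃acl : {n : ℕ} → (Fin n → List ℕ) → Imag n → Set₁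
⋃acl {n} A e = Σ (Fin n) λ i → aclΩ (A i) e

⋃ : {n : ℕ} → (Fin n → List ℕ) → List ℕ
⋃ {n} A = List.concat (tabulate A)

-- An automorphism gσ fixing ⋃ Aᵢ pointwise becomes, after composition with one of finitely
-- many flips (determined by the values of g on the (n-1)-subsets of ⋃ Aᵢ), an automorphism
-- that fixes ⋃ Aᵢ and whose g vanishes on every [Aᵢ]^{n-1}.  Such an automorphism fixes each
-- acl(Aᵢ) pointwise, so a finite orbit over acl(A₁), …, acl(Aₙ) yields a finite orbit over
-- ⋃ Aᵢ; the converse holds since Aᵢ ⊆ acl(Aᵢ).
--
-- That these automorphisms fix acl(A) is a pigeonhole argument: if c has a finite orbit over
-- A and its Ω-support lies below N, then of finitely many far-apart translates of the support
-- outside A two give E-equivalent images, which forces c to be fixed by the involution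
-- swapping its support outside A with any fresh copy.  A permutation fixing A, and a flip by
-- a function vanishing on [A]^{n-1}, can each be conjugated by such involutions into one that
-- acts trivially on the support of c.

module Submission where

open import Defs
open import Data.Nat using (ℕ; _≤_)
open import Data.Fin using (Fin)
open import Data.List using (List)
open import Function.Bundles using (_⇔_)

open import Algebra.Bundles using (CommutativeRing)
import Algebra.Properties.CommutativeSemigroup
open import Data.Bool using (Bool; true; false; _xor_; if_then_else_)
import Data.Bool.Properties as Boolₚ
open import Data.Empty using (⊥-elim)
open import Data.Fin as Fin using (zero; suc; punchIn; toℕ)
import Data.Fin.Properties as Finₚ
open import Data.List using ([]; _∷_; length; cartesianProductWith)
import Data.List
open import Data.List.Membership.Propositional using () renaming (_∈_ to _∈ₗ_)
import Data.List.Membership.Propositional.Properties as List∈ₚ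
open import Data.List.Relation.Unary.Any as Any using (Any; here; there)
import Data.List.Relation.Unary.Any.Properties as Anyₚ
open import Data.Maybe as Maybe using (Maybe; just; nothing)
import Data.Maybe.Properties as Maybeₚ
open import Data.Nat using (zero; suc; pred; _<_; _⊔_; _+_; _*_; _∸_; _<?_; _≟_)
import Data.Nat.Properties as ℕₚ
open import Data.List.Membership.DecPropositional _≟_ using (_∈?_)
open import Data.Product using (∃; ∃₂; _×_; _,_; proj₁; proj₂)
open import Data.Sum using ([_,_]′)
open import Data.Vec using (Vec; []; _∷_; lookup; map)
import Data.Vec.Properties as Vecₚ
open import Data.Vec.Membership.Propositional using (_∈_)
import Data.Vec.Membership.Propositional.Properties as Vec∈ₚ
import Data.Vec.Membership.DecPropositional _≟_ as Vec∈?
import Data.Vec.Relation.Unary.Any as VecAny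
open import Data.Vec.Relation.Unary.All using (All; []; _∷_)
import Data.Vec.Relation.Unary.All as All
import Data.Vec.Relation.Unary.All.Properties as Allₚ
open import Function using (_∘_; id)
open import Function.Bundles using (_⤖_; Bijection; Inverse; mk↔ₛ′; mk⇔)
open import Function.Construct.Composition using (_⤖-∘_)
open import Function.Construct.Identity using (⤖-id)
open import Function.Properties.Bijection using (⤖⇒↔)
open import Function.Properties.Inverse using (↔⇒⤖)
open import Level using (0ℓ; Lift; lift)
open import Relation.Binary.Bundles using (Setoid)
open import Relation.Binary.PropositionalEquality
  using (_≡_; _≢_; refl; sym; trans; cong; cong₂; subst; module ≡-Reasoning)
import Relation.Binary.Reasoning.Setoid as SetoidReasoning
open import Relation.Nullary using (¬_; yes; no; does; contradiction)
open import Relation.Nullary.Decidable as Dec using (Dec; _×-dec_; _→-dec_; ¬?; does-⇔)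
open import Relation.Unary using (Decidable)

open Aut

xor-interchange : ∀ a b c d → (a xor b) xor (c xor d) ≡ (a xor c) xor (b xor d)
xor-interchange =
  Interchange.interchange
  where module Interchange = Algebra.Properties.CommutativeSemigroup
          (CommutativeRing.+-commutativeSemigroup Boolₚ.xor-∧-commutativeRing)

xor-cancelʳ : ∀ x y → (x xor y) xor y ≡ x
xor-cancelʳ x y = trans (Boolₚ.xor-assoc x y y)
                        (trans (cong (x xor_) (Boolₚ.xor-same y)) (Boolₚ.xor-identityʳ x))

<-weaken : {x N M : ℕ} → N ≤ M → x < N → x < M
<-weaken N≤M x<N = ℕₚ.<-≤-trans x<N N≤M

cong-trans : {A B : Set} {a b : A} {c : B} (f : A → B) → a ≡ b → f b ≡ c → f a ≡ c
cong-trans f a≡b fb≡c = trans (cong f a≡b) fb≡c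

<⇒≢shift : {x N D y : ℕ} → x < N → N ≤ D → D + y ≢ x
<⇒≢shift {D = D} {y} x<N N≤D eq =
  ℕₚ.<⇒≢ (ℕₚ.<-≤-trans x<N (ℕₚ.≤-trans N≤D (ℕₚ.m≤m+n D y))) (sym eq)

translates-spaced : (D N j k : ℕ) → j < k → D + N * j + N ≤ D + N * k
translates-spaced D N j k j<k = begin
  D + N * j + N    ≡⟨ ℕₚ.+-assoc D (N * j) N ⟩
  D + (N * j + N)  ≡⟨ cong (D +_) (ℕₚ.+-comm (N * j) N) ⟩
  D + (N + N * j)  ≡⟨ cong (D +_) (ℕₚ.*-suc N j) ⟨
  D + N * suc j    ≤⟨ ℕₚ.+-monoʳ-≤ D (ℕₚ.*-monoʳ-≤ N j<k) ⟩
  D + N * k        ∎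
  where open ℕₚ.≤-Reasoning

∃-both : {P Q : ℕ → Set} → (∀ {N M} → N ≤ M → P N → P M) → (∀ {N M} → N ≤ M → Q N → Q M) →
         ∃ P → ∃ Q → ∃ λ N → P N × Q N
∃-both P↑ Q↑ (N , pN) (M , qM) = N ⊔ M , P↑ (ℕₚ.m≤m⊔n N M) pN , Q↑ (ℕₚ.m≤n⊔m N M) qM

vecBound : {k : ℕ} (w : Vec ℕ k) → ∃ λ N → All (_< N) w
vecBound [] = 0 , []
vecBound (x ∷ w) with ∃-both <-weaken (λ N≤M → All.map (<-weaken N≤M))
                             (suc x , ℕₚ.≤-refl) (vecBound w)
... | N , x<N , w<N = N , x<N ∷ w<N

listBound : (A : List ℕ) → ∃ λ N → ∀ {x} → x ∈ₗ A → x < N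
listBound [] = 0 , λ ()
listBound (x ∷ A) with ∃-both <-weaken (λ N≤M A<N {y} y∈ → <-weaken N≤M (A<N y∈))
                              (suc x , ℕₚ.≤-refl) (listBound A)
... | N , x<N , A<N = N , λ { (here refl) → x<N ; (there x∈) → A<N x∈ }

imageBound : (f : ℕ → ℕ) (N : ℕ) → ∃ λ D → ∀ y → y < N → f y < D
imageBound f zero = 0 , λ _ ()
imageBound f (suc N) with ∃-both (λ N≤M f<D y y<N → <-weaken N≤M (f<D y y<N)) <-weaken
                                 (imageBound f N) (suc (f N) , ℕₚ.≤-refl)
... | D , f<D , fN<D = D , λ y y<1+N → [ f<D y , (λ { refl → fN<D }) ]′ (ℕₚ.m<1+n⇒m<n∨m≡n y<1+N)

map-cong-All : {A B : Set} {P : A → Set} {k : ℕ} {s t : A → B} {v : Vec A k} →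
               All P v → (∀ {y} → P y → s y ≡ t y) → map s v ≡ map t v
map-cong-All [] s≗t = refl
map-cong-All (py ∷ pv) s≗t = cong₂ _∷_ (s≗t py) (map-cong-All pv s≗t)

removeAt'-map : {A B : Set} {k : ℕ} (s : A → B) (w : Vec A k) (i : Fin k) →
                removeAt' (map s w) i ≡ map s (removeAt' w i)
removeAt'-map s (x ∷ xs) zero = refl
removeAt'-map s (x ∷ y ∷ ys) (suc i) = cong (s x ∷_) (removeAt'-map s (y ∷ ys) i)

removeAt'-lookup : {A : Set} {k : ℕ} (w : Vec A (suc k)) (i : Fin (suc k)) (j : Fin k) →
                   lookup (removeAt' w i) j ≡ lookup w (punchIn i j)
removeAt'-lookup (x ∷ xs) zero j = refl
removeAt'-lookup (x ∷ y ∷ ys) (suc i) zero = refl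
removeAt'-lookup (x ∷ y ∷ ys) (suc i) (suc j) = removeAt'-lookup (y ∷ ys) i j

removeAt'-all : {A : Set} {P : A → Set} {k : ℕ} (w : Vec A k) (i : Fin k) →
                All P w → All P (removeAt' w i)
removeAt'-all (x ∷ xs) zero (_ ∷ ps) = ps
removeAt'-all (x ∷ y ∷ ys) (suc i) (p ∷ ps) = p ∷ removeAt'-all (y ∷ ys) i ps

removeAt'-distinct : {k : ℕ} (w : Vec ℕ k) (i : Fin k) → Distinct w → Distinct (removeAt' w i)
removeAt'-distinct {suc k} w i d j j′ eq = Finₚ.punchIn-injective i j j′
  (d _ _ (trans (sym (removeAt'-lookup w i j)) (trans eq (removeAt'-lookup w i j′))))

SameSet-refl : {k : ℕ} (v : Vec ℕ k) → SameSet v v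
SameSet-refl v x = id , id

SameSet-sym : {k : ℕ} {v w : Vec ℕ k} → SameSet v w → SameSet w v
SameSet-sym v≈w x = proj₂ (v≈w x) , proj₁ (v≈w x)

SameSet-trans : {k : ℕ} {u v w : Vec ℕ k} → SameSet u v → SameSet v w → SameSet u w
SameSet-trans u≈v v≈w x = proj₁ (v≈w x) ∘ proj₁ (u≈v x) , proj₂ (u≈v x) ∘ proj₂ (v≈w x)

∈-map⁻ : {k : ℕ} (s : ℕ → ℕ) {x : ℕ} (v : Vec ℕ k) → x ∈ map s v → ∃ λ y → y ∈ v × x ≡ s y
∈-map⁻ s (y ∷ v) (VecAny.here x≡sy) = y , VecAny.here refl , x≡sy
∈-map⁻ s (y ∷ v) (VecAny.there x∈) with ∈-map⁻ s v x∈
... | z , z∈v , x≡sz = z , VecAny.there z∈v , x≡sz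

SameSet-map : {k : ℕ} (s : ℕ → ℕ) {v w : Vec ℕ k} → SameSet v w → SameSet (map s v) (map s w)
SameSet-map s {v} {w} v≈w x = transfer v≈w , transfer (SameSet-sym v≈w)
  where
  transfer : {u u′ : Vec ℕ _} → SameSet u u′ → x ∈ map s u → x ∈ map s u′
  transfer {u} u≈u′ x∈ with ∈-map⁻ s u x∈
  ... | y , y∈u , refl = Vec∈ₚ.∈-map⁺ s (proj₁ (u≈u′ y) y∈u)

All-∈ : {P : ℕ → Set} {k : ℕ} (w : Vec ℕ k) → (∀ {x} → x ∈ w → P x) → All P w
All-∈ [] _ = []
All-∈ (x ∷ w) P-w = P-w (VecAny.here refl) ∷ All-∈ w (P-w ∘ VecAny.there)

All-SameSet : {P : ℕ → Set} {k : ℕ} {v w : Vec ℕ k} → SameSet v w → All P v → All P w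
All-SameSet {w = w} v≈w P-v = All-∈ w (λ x∈w → All.lookup P-v (proj₂ (v≈w _) x∈w))

RespectsSameSet : {k : ℕ} → (Vec ℕ k → Bool) → Set
RespectsSameSet {k} g = (v w : Vec ℕ k) → Distinct v → Distinct w → SameSet v w → g v ≡ g w

restrictBelow : {k : ℕ} → ℕ → (Vec ℕ k → Bool) → Vec ℕ k → Bool
restrictBelow N g v = if does (All.all? (_<? N) v) then g v else false

module _ {k : ℕ} (N : ℕ) (g : Vec ℕ k → Bool) where

  restrictBelow-below : {v : Vec ℕ k} → All (_< N) v → restrictBelow N g v ≡ g v
  restrictBelow-below {v} v<N with All.all? (_<? N) v
  ... | yes _ = refl
  ... | no v≮N = contradiction v<N v≮N

  restrictBelow-false : {v : Vec ℕ k} → (All (_< N) v → g v ≡ false) → restrictBelow N g v ≡ false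
  restrictBelow-false {v} g≡false with All.all? (_<? N) v
  ... | yes v<N = g≡false v<N
  ... | no _ = refl

  restrictBelow-wd : RespectsSameSet g → RespectsSameSet (restrictBelow N g)
  restrictBelow-wd g-wd v w dv dw v≈w with All.all? (_<? N) v
  ... | yes v<N = trans (g-wd v w dv dw v≈w)
                        (sym (restrictBelow-below (All-SameSet v≈w v<N)))
  ... | no v≮N =
    sym (restrictBelow-false λ w<N → contradiction (All-SameSet (SameSet-sym v≈w) w<N) v≮N)

-- The coboundary β*

sumF₂-cong : {k : ℕ} {g h : Fin k → Bool} → (∀ i → g i ≡ h i) → sumF₂ g ≡ sumF₂ h
sumF₂-cong {zero} _ = refl
sumF₂-cong {suc k} g≗h = cong₂ _xor_ (g≗h zero) (sumF₂-cong (g≗h ∘ suc))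

sumF₂-false : (k : ℕ) → sumF₂ {k} (λ _ → false) ≡ false
sumF₂-false zero = refl
sumF₂-false (suc k) = sumF₂-false k

sumF₂-xor : {k : ℕ} (g h : Fin k → Bool) →
            sumF₂ (λ i → g i xor h i) ≡ sumF₂ g xor sumF₂ h
sumF₂-xor {zero} g h = refl
sumF₂-xor {suc k} g h =
  trans (cong ((g zero xor h zero) xor_) (sumF₂-xor (g ∘ suc) (h ∘ suc)))
        (xor-interchange (g zero) (h zero) (sumF₂ (g ∘ suc)) (sumF₂ (h ∘ suc)))

module _ (n : ℕ) where

  β*-faces : {f g : Vec ℕ (pred n) → Bool} (w : Vec ℕ n) →
             (∀ i → f (removeAt' w i) ≡ g (removeAt' w i)) → β* n f w ≡ β* n g w
  β*-faces w = sumF₂-cong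

  β*-false : (w : Vec ℕ n) → β* n (λ _ → false) w ≡ false
  β*-false w = sumF₂-false n

  β*-xor : (f g : Vec ℕ (pred n) → Bool) (w : Vec ℕ n) →
           β* n (λ v → f v xor g v) w ≡ β* n f w xor β* n g w
  β*-xor f g w = sumF₂-xor (f ∘ removeAt' w) (g ∘ removeAt' w)

  β*-map : (f : Vec ℕ (pred n) → Bool) (s : ℕ → ℕ) (w : Vec ℕ n) →
           β* n (f ∘ map s) w ≡ β* n f (map s w)
  β*-map f s w = sumF₂-cong (λ i → cong f (sym (removeAt'-map s w i)))

module _ {n : ℕ} where

  ≈P-refl : (p : Pt n) → p ≈P p
  ≈P-refl (elt x) = elt≈
  ≈P-refl (sub w d) = sub≈ (SameSet-refl w)
  ≈P-refl (fib w d b) = fib≈ (SameSet-refl w)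

  ≈P-sym : {p q : Pt n} → p ≈P q → q ≈P p
  ≈P-sym elt≈ = elt≈
  ≈P-sym (sub≈ s) = sub≈ (SameSet-sym s)
  ≈P-sym (fib≈ s) = fib≈ (SameSet-sym s)

  ≈P-trans : {p q r : Pt n} → p ≈P q → q ≈P r → p ≈P r
  ≈P-trans elt≈ elt≈ = elt≈
  ≈P-trans (sub≈ s) (sub≈ t) = sub≈ (SameSet-trans s t)
  ≈P-trans (fib≈ s) (fib≈ t) = fib≈ (SameSet-trans s t)

  sub-cong : {v w : Vec ℕ n} {dv : Distinct v} {dw : Distinct w} →
             v ≡ w → sub v dv ≈P sub w dw
  sub-cong refl = sub≈ (SameSet-refl _)

  fib-cong : {v w : Vec ℕ n} {dv : Distinct v} {dw : Distinct w} {b b′ : Bool} →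
             v ≡ w → b ≡ b′ → fib v dv b ≈P fib w dw b′
  fib-cong refl refl = fib≈ (SameSet-refl _)

  ≈T-refl : {k : ℕ} (a : Vec (Pt n) k) → a ≈T a
  ≈T-refl a i = ≈P-refl (lookup a i)

  ≈T-sym : {k : ℕ} {a b : Vec (Pt n) k} → a ≈T b → b ≈T a
  ≈T-sym a≈b i = ≈P-sym (a≈b i)

  ≈T-trans : {k : ℕ} {a b c : Vec (Pt n) k} → a ≈T b → b ≈T c → a ≈T c
  ≈T-trans a≈b b≈c i = ≈P-trans (a≈b i) (b≈c i)

  ≈T-setoid : ℕ → Setoid 0ℓ 0ℓ
  ≈T-setoid k = record
    { Carrier = Vec (Pt n) k
    ; _≈_ = _≈T_
    ; isEquivalence = record
        { refl = λ {a} → ≈T-refl a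
        ; sym = λ {a} {b} → ≈T-sym {a = a} {b}
        ; trans = λ {a} {b} {c} → ≈T-trans {a = a} {b} {c}
        }
    }

  module ≈T-Reasoning {k : ℕ} = SetoidReasoning (≈T-setoid k)

  actT-pointwise : {k : ℕ} (h h′ : Aut n) (a : Vec (Pt n) k) →
                   (∀ i → actP h (lookup a i) ≈P actP h′ (lookup a i)) → actT h a ≈T actT h′ a
  actT-pointwise h h′ a eq i
    rewrite Vecₚ.lookup-map i (actP h) a | Vecₚ.lookup-map i (actP h′) a = eq i

  permAut : ℕ ⤖ ℕ → Aut n
  permAut s = record { f = λ _ → false ; f-wd = λ _ _ _ _ _ → refl ; σ = s }

  flipAut : (g : Vec ℕ (pred n) → Bool) → RespectsSameSet g → Aut n
  flipAut g g-wd = record { f = g ; f-wd = g-wd ; σ = ⤖-id ℕ }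

  infixr 9 _∘ᴬ_

  _∘ᴬ_ : Aut n → Aut n → Aut n
  h₁ ∘ᴬ h₂ = record
    { f = λ v → f h₂ v xor f h₁ (map s₂ v)
    ; f-wd = λ v w dv dw v≈w →
        cong₂ _xor_ (f-wd h₂ v w dv dw v≈w)
                    (f-wd h₁ _ _ (map-distinct (σ h₂) v dv) (map-distinct (σ h₂) w dw)
                                 (SameSet-map s₂ v≈w))
    ; σ = σ h₁ ⤖-∘ σ h₂
    }
    where s₂ = Bijection.to (σ h₂)

  actP-∘ : (h₁ h₂ : Aut n) (p : Pt n) → actP h₁ (actP h₂ p) ≈P actP (h₁ ∘ᴬ h₂) p
  actP-∘ h₁ h₂ (elt x) = elt≈
  actP-∘ h₁ h₂ (sub w d) = sub-cong (sym (Vecₚ.map-∘ _ _ w))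
  actP-∘ h₁ h₂ (fib w d b) = fib-cong (sym (Vecₚ.map-∘ _ _ w)) (begin
    (b xor β* n (f h₂) w) xor β* n (f h₁) (map s₂ w)  ≡⟨ Boolₚ.xor-assoc b _ _ ⟩
    b xor (β* n (f h₂) w xor β* n (f h₁) (map s₂ w))  ≡⟨ cong (λ z → b xor (β* n (f h₂) w xor z))
                                                           (β*-map n (f h₁) s₂ w) ⟨
    b xor (β* n (f h₂) w xor β* n (f h₁ ∘ map s₂) w)  ≡⟨ cong (b xor_) (β*-xor n (f h₂) (f h₁ ∘ map s₂) w) ⟨
    b xor β* n (f (h₁ ∘ᴬ h₂)) w                       ∎)
    where open ≡-Reasoning
          s₂ = Bijection.to (σ h₂)

  actT-∘ : {k : ℕ} (h₁ h₂ : Aut n) (a : Vec (Pt n) k) →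
           actT h₁ (actT h₂ a) ≈T actT (h₁ ∘ᴬ h₂) a
  actT-∘ h₁ h₂ a i
    rewrite Vecₚ.lookup-map i (actP h₁) (actT h₂ a) | Vecₚ.lookup-map i (actP h₂) a
          | Vecₚ.lookup-map i (actP (h₁ ∘ᴬ h₂)) a = actP-∘ h₁ h₂ (lookup a i)

  Below : ℕ → Pt n → Set
  Below N (elt x) = x < N
  Below N (sub w _) = All (_< N) w
  Below N (fib w _ _) = All (_< N) w

  BelowT : {k : ℕ} → ℕ → Vec (Pt n) k → Set
  BelowT N a = ∀ i → Below N (lookup a i)

  record AgreeBelow (N : ℕ) (h h′ : Aut n) : Set where
    field
      σ-agree : ∀ y → y < N → Bijection.to (σ h) y ≡ Bijection.to (σ h′) y
      f-agree : ∀ v → Distinct v → All (_< N) v → f h v ≡ f h′ v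

  actP-agree : {N : ℕ} (h h′ : Aut n) → AgreeBelow N h h′ →
               (p : Pt n) → Below N p → actP h p ≈P actP h′ p
  actP-agree h h′ agree (elt x) x<N rewrite AgreeBelow.σ-agree agree x x<N = elt≈
  actP-agree h h′ agree (sub w d) w<N = sub-cong (map-cong-All w<N (σ-agree _))
    where open AgreeBelow agree
  actP-agree h h′ agree (fib w d b) w<N =
    fib-cong (map-cong-All w<N (σ-agree _))
             (cong (b xor_) (β*-faces n {f h} {f h′} w (λ i → f-agree _ (removeAt'-distinct w i d)
                                                          (removeAt'-all w i w<N))))
    where open AgreeBelow agree

  actT-agree : {k N : ℕ} (h h′ : Aut n) → AgreeBelow N h h′ →
               (a : Vec (Pt n) k) → BelowT N a → actT h a ≈T actT h′ a
  actT-agree h h′ agree a a<N = actT-pointwise h h′ a (λ i → actP-agree h h′ agree _ (a<N i))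

  idAut : Aut n
  idAut = permAut (⤖-id ℕ)

  actP-id : (p : Pt n) → actP idAut p ≈P p
  actP-id (elt x) = elt≈
  actP-id (sub w d) = sub-cong (Vecₚ.map-id w)
  actP-id (fib w d b) =
    fib-cong (Vecₚ.map-id w) (trans (cong (b xor_) (β*-false n w)) (Boolₚ.xor-identityʳ b))

  actT-id : {k : ℕ} (a : Vec (Pt n) k) → actT idAut a ≈T a
  actT-id a i rewrite Vecₚ.lookup-map i (actP idAut) a = actP-id (lookup a i)

  Below-mono : {N M : ℕ} → N ≤ M → (p : Pt n) → Below N p → Below M p
  Below-mono N≤M (elt x) x<N = ℕₚ.<-≤-trans x<N N≤M
  Below-mono N≤M (sub w _) w<N = All.map (λ y<N → ℕₚ.<-≤-trans y<N N≤M) w<N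
  Below-mono N≤M (fib w _ _) w<N = All.map (λ y<N → ℕₚ.<-≤-trans y<N N≤M) w<N

  BelowT-mono : {k N M : ℕ} → N ≤ M → (a : Vec (Pt n) k) → BelowT N a → BelowT M a
  BelowT-mono N≤M a a<N i = Below-mono N≤M _ (a<N i)

  actP-below : {N M : ℕ} (h : Aut n) → (∀ y → y < N → Bijection.to (σ h) y < M) →
               (p : Pt n) → Below N p → Below M (actP h p)
  actP-below h σ<M (elt x) x<N = σ<M x x<N
  actP-below h σ<M (sub w d) w<N = Allₚ.map⁺ (All.map (σ<M _) w<N)
  actP-below h σ<M (fib w d b) w<N = Allₚ.map⁺ (All.map (σ<M _) w<N)

  actT-below : {k N M : ℕ} (h : Aut n) → (∀ y → y < N → Bijection.to (σ h) y < M) →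
               (a : Vec (Pt n) k) → BelowT N a → BelowT M (actT h a)
  actT-below h σ<M a a<N i rewrite Vecₚ.lookup-map i (actP h) a = actP-below h σ<M _ (a<N i)

  pointBound : (p : Pt n) → ∃ λ N → Below N p
  pointBound (elt x) = suc x , ℕₚ.≤-refl
  pointBound (sub w _) = vecBound w
  pointBound (fib w _ _) = vecBound w

  tupleBound : {k : ℕ} (a : Vec (Pt n) k) → ∃ λ N → BelowT N a
  tupleBound [] = 0 , λ ()
  tupleBound (p ∷ a) with ∃-both (λ N≤M → Below-mono N≤M p) (λ N≤M → BelowT-mono N≤M a)
                                 (pointBound p) (tupleBound a)
  ... | N , p<N , a<N = N , λ { zero → p<N ; (suc i) → a<N i }

  commonBound : {k : ℕ} (a : Vec (Pt n) k) (A : List ℕ) →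
                ∃ λ N → BelowT N a × (∀ {x} → x ∈ₗ A → x < N)
  commonBound a A = ∃-both (λ N≤M → BelowT-mono N≤M a) (λ N≤M A<N {x} x∈ → <-weaken N≤M (A<N x∈))
                           (tupleBound a) (listBound A)

  infixr 25 _·_

  _·_ : {k : ℕ} → ℕ ⤖ ℕ → Vec (Pt n) k → Vec (Pt n) k
  s · a = actT (permAut s) a

  ·-∘ : {k : ℕ} (s t : ℕ ⤖ ℕ) (a : Vec (Pt n) k) → s · t · a ≈T (s ⤖-∘ t) · a
  ·-∘ s t = actT-∘ (permAut s) (permAut t)

  ·-agree : {k N : ℕ} (s t : ℕ ⤖ ℕ) → (∀ y → y < N → Bijection.to s y ≡ Bijection.to t y) →
            (a : Vec (Pt n) k) → BelowT N a → s · a ≈T t · a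
  ·-agree s t s≗t = actT-agree (permAut s) (permAut t)
                      (record { σ-agree = s≗t ; f-agree = λ _ _ _ → refl })

-- Swapping a set with disjoint copies of itself

involution⤖ : (s : ℕ → ℕ) → (∀ x → s (s x) ≡ x) → ℕ ⤖ ℕ
involution⤖ s s∘s = ↔⇒⤖ (mk↔ₛ′ s s s∘s s∘s)

module PairSwap
  {Dom : ℕ → Set} (Dom? : Decidable Dom) (P Q P⁻ Q⁻ : ℕ → ℕ)
  (P⁻∘P : ∀ y → P⁻ (P y) ≡ y) (Q⁻∘Q : ∀ y → Q⁻ (Q y) ≡ y)
  (P≢Q : ∀ {y y′} → Dom y → Dom y′ → P y ≢ Q y′)
  where

  data View (z : ℕ) : Set where
    inP : ∀ y → Dom y → P y ≡ z → View z
    inQ : ∀ y → Dom y → Q y ≡ z → View z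
    outside : (∀ {y} → Dom y → P y ≢ z) → (∀ {y} → Dom y → Q y ≢ z) → View z

  private
    canonical : (F F⁻ : ℕ → ℕ) → (∀ y → F⁻ (F y) ≡ y) →
                ∀ {y z} → Dom y → F y ≡ z → Dom (F⁻ z) × F (F⁻ z) ≡ z
    canonical F F⁻ F⁻∘F {y} d refl rewrite F⁻∘F y = d , refl

  view : ∀ z → View z
  view z with Dom? (P⁻ z) ×-dec P (P⁻ z) ≟ z | Dom? (Q⁻ z) ×-dec Q (Q⁻ z) ≟ z
  ... | yes (d , eq) | _ = inP _ d eq
  ... | no _ | yes (d , eq) = inQ _ d eq
  ... | no ¬p | no ¬q = outside (λ d eq → ¬p (canonical P P⁻ P⁻∘P d eq))
                                (λ d eq → ¬q (canonical Q Q⁻ Q⁻∘Q d eq))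

  partner : ∀ {z} → View z → ℕ
  partner (inP y _ _) = Q y
  partner (inQ y _ _) = P y
  partner {z} (outside _ _) = z

  partner-P : ∀ {y} → Dom y → (v : View (P y)) → partner v ≡ Q y
  partner-P _ (inP y′ _ eq) = cong Q (trans (sym (P⁻∘P y′)) (trans (cong P⁻ eq) (P⁻∘P _)))
  partner-P d (inQ y′ d′ eq) = contradiction (sym eq) (P≢Q d d′)
  partner-P d (outside ¬P _) = contradiction refl (¬P d)

  partner-Q : ∀ {y} → Dom y → (v : View (Q y)) → partner v ≡ P y
  partner-Q d (inP y′ d′ eq) = contradiction eq (P≢Q d′ d)
  partner-Q _ (inQ y′ _ eq) = cong P (trans (sym (Q⁻∘Q y′)) (trans (cong Q⁻ eq) (Q⁻∘Q _)))
  partner-Q d (outside _ ¬Q) = contradiction refl (¬Q d)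

  -- Opaque: unfolding swap into its decision procedures makes unification very slow.
  opaque
    swap : ℕ → ℕ
    swap z = partner (view z)

  opaque
    unfolding swap
    swap-P : ∀ {y} → Dom y → swap (P y) ≡ Q y
    swap-P d = partner-P d (view _)

    swap-Q : ∀ {y} → Dom y → swap (Q y) ≡ P y
    swap-Q d = partner-Q d (view _)

    swap-outside : ∀ {z} → (∀ {y} → Dom y → P y ≢ z) → (∀ {y} → Dom y → Q y ≢ z) → swap z ≡ z
    swap-outside {z} ¬P ¬Q with view z
    ... | inP _ d eq = contradiction eq (¬P d)
    ... | inQ _ d eq = contradiction eq (¬Q d)
    ... | outside _ _ = refl

    swap-involutive : ∀ z → swap (swap z) ≡ z
    swap-involutive z with view z
    ... | inP y d refl = trans (cong swap (partner-P d (inP y d refl))) (swap-Q d)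
    ... | inQ y d refl = trans (cong swap (partner-Q d (inQ y d refl))) (swap-P d)
    ... | outside ¬P ¬Q = swap-outside ¬P ¬Q

  swap⤖ : ℕ ⤖ ℕ
  swap⤖ = involution⤖ swap swap-involutive

module Shift (A : List ℕ) where

  Moved : ℕ → ℕ → Set
  Moved N y = y < N × ¬ (y ∈ₗ A)

  moved? : (N : ℕ) → Decidable (Moved N)
  moved? N y = (y <? N) ×-dec (¬? (y ∈? A))

  shifts-disjoint : {N D₁ D₂ : ℕ} → D₁ + N ≤ D₂ →
                    ∀ {y y′} → Moved N y → Moved N y′ → D₁ + y ≢ D₂ + y′
  shifts-disjoint {N} {D₁} sep (y<N , _) _ eq = <⇒≢shift (ℕₚ.+-monoʳ-< D₁ y<N) sep (sym eq)

  module ShiftSwap (N D₁ D₂ : ℕ) (sep : D₁ + N ≤ D₂) =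
    PairSwap (moved? N) (D₁ +_) (D₂ +_) (_∸ D₁) (_∸ D₂)
             (ℕₚ.m+n∸m≡n D₁) (ℕₚ.m+n∸m≡n D₂) (shifts-disjoint sep)

  τ : {N D : ℕ} → N ≤ D → ℕ ⤖ ℕ
  τ {N} {D} N≤D = ShiftSwap.swap⤖ N 0 D N≤D

  τ-moved : {N D : ℕ} (N≤D : N ≤ D) {y : ℕ} → y < N → ¬ (y ∈ₗ A) → Bijection.to (τ N≤D) y ≡ D + y
  τ-moved {N} {D} N≤D y<N y∉A = ShiftSwap.swap-P N 0 D N≤D (y<N , y∉A)

  τ-fixes-A : {N D : ℕ} (N≤D : N ≤ D) {x : ℕ} → x < N → x ∈ₗ A → Bijection.to (τ N≤D) x ≡ x
  τ-fixes-A {N} {D} N≤D x<N x∈A =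
    ShiftSwap.swap-outside N 0 D N≤D (λ { (_ , y∉A) refl → y∉A x∈A }) (λ _ → <⇒≢shift x<N N≤D)

  shiftSwap-fixes-low : (N D₁ D₂ : ℕ) (sep : D₁ + N ≤ D₂) {z : ℕ} → z < D₁ →
                        ShiftSwap.swap N D₁ D₂ sep z ≡ z
  shiftSwap-fixes-low N D₁ D₂ sep z<D₁ = ShiftSwap.swap-outside N D₁ D₂ sep
    (λ _ → <⇒≢shift z<D₁ ℕₚ.≤-refl)
    (λ _ → <⇒≢shift z<D₁ (ℕₚ.≤-trans (ℕₚ.m≤m+n D₁ N) sep))

  shiftSwap-fixes-high : (N D₁ D₂ : ℕ) (sep : D₁ + N ≤ D₂) {z : ℕ} → D₂ + N ≤ z →
                         ShiftSwap.swap N D₁ D₂ sep z ≡ z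
  shiftSwap-fixes-high N D₁ D₂ sep D₂+N≤z = ShiftSwap.swap-outside N D₁ D₂ sep
    (λ (y<N , _) → ℕₚ.<⇒≢ (ℕₚ.<-≤-trans (ℕₚ.+-monoʳ-< D₁ y<N)
                          (ℕₚ.≤-trans sep (ℕₚ.≤-trans (ℕₚ.m≤m+n D₂ N) D₂+N≤z))))
    (λ (y<N , _) → ℕₚ.<⇒≢ (ℕₚ.<-≤-trans (ℕₚ.+-monoʳ-< D₂ y<N) D₂+N≤z))

  τ-fixes-τ : {N Dⱼ Dₖ : ℕ} (N≤Dⱼ : N ≤ Dⱼ) (N≤Dₖ : N ≤ Dₖ) → Dⱼ + N ≤ Dₖ →
              ∀ y → y < N → Bijection.to (τ N≤Dⱼ) (Bijection.to (τ N≤Dₖ) y) ≡ Bijection.to (τ N≤Dₖ) y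
  τ-fixes-τ {N} {Dⱼ} {Dₖ} N≤Dⱼ N≤Dₖ Dⱼ+N≤Dₖ y y<N with y ∈? A
  ... | yes y∈A = cong-trans (Bijection.to (τ N≤Dⱼ)) (τ-fixes-A N≤Dₖ y<N y∈A)
                    (trans (τ-fixes-A N≤Dⱼ y<N y∈A) (sym (τ-fixes-A N≤Dₖ y<N y∈A)))
  ... | no y∉A = cong-trans (Bijection.to (τ N≤Dⱼ)) (τ-moved N≤Dₖ y<N y∉A)
                   (trans (shiftSwap-fixes-high N 0 Dⱼ N≤Dⱼ (ℕₚ.≤-trans Dⱼ+N≤Dₖ (ℕₚ.m≤m+n Dₖ y)))
                          (sym (τ-moved N≤Dₖ y<N y∉A)))

  shiftSwap-τ : {N D Dₖ : ℕ} (N≤D : N ≤ D) (N≤Dₖ : N ≤ Dₖ) (sep : D + N ≤ Dₖ) →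
                ∀ y → y < N → ShiftSwap.swap N D Dₖ sep (Bijection.to (τ N≤Dₖ) y) ≡ Bijection.to (τ N≤D) y
  shiftSwap-τ {N} {D} {Dₖ} N≤D N≤Dₖ sep y y<N with y ∈? A
  ... | yes y∈A = cong-trans (ShiftSwap.swap N D Dₖ sep) (τ-fixes-A N≤Dₖ y<N y∈A)
                    (trans (shiftSwap-fixes-low N D Dₖ sep (<-weaken N≤D y<N))
                           (sym (τ-fixes-A N≤D y<N y∈A)))
  ... | no y∉A = cong-trans (ShiftSwap.swap N D Dₖ sep) (τ-moved N≤Dₖ y<N y∉A)
                   (trans (ShiftSwap.swap-Q N D Dₖ sep (y<N , y∉A)) (sym (τ-moved N≤D y<N y∉A)))

  reroute : {N D : ℕ} (N≤D : N ≤ D) → (∀ {x} → x ∈ₗ A → x < N) →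
            (s : ℕ ⤖ ℕ) → (∀ x → x ∈ₗ A → Bijection.to s x ≡ x) → (∀ y → y < N → Bijection.to s y < D) →
            ∃ λ ψ → (∀ y → y < N → Bijection.to ψ (Bijection.to (τ N≤D) y) ≡ Bijection.to (τ N≤D) y)
                  × (∀ y → y < N → Bijection.to ψ (Bijection.to (τ (ℕₚ.≤-refl {D + N}))
                                                               (Bijection.to (τ N≤D) y))
                                    ≡ Bijection.to s y)
  reroute {N} {D} N≤D A<N s s-fix s<D = Ψ.swap⤖ , ψτ₁≗τ₁ , ψτ₂τ₁≗s
    where
    N′ = D + N
    τ₁ = τ N≤D
    τ₂ = τ (ℕₚ.≤-refl {N′})

    module Ψ = PairSwap (moved? N) (λ y → N′ + (D + y)) (Bijection.to s)
      (λ z → z ∸ N′ ∸ D) (Inverse.from (⤖⇒↔ s))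
      (λ y → trans (cong (_∸ D) (ℕₚ.m+n∸m≡n N′ (D + y))) (ℕₚ.m+n∸m≡n D y))
      (Inverse.strictlyInverseʳ (⤖⇒↔ s))
      (λ _ (y′<N , _) → <⇒≢shift (s<D _ y′<N) (ℕₚ.m≤m+n D N))

    ψ-fixes-A : ∀ {y} → y < N → y ∈ₗ A → Ψ.swap y ≡ y
    ψ-fixes-A y<N y∈A = Ψ.swap-outside
      (λ _ → <⇒≢shift y<N (ℕₚ.≤-trans N≤D (ℕₚ.m≤m+n D N)))
      (λ (_ , y′∉A) s-y′≡y → y′∉A (subst (_∈ₗ A)
        (sym (Bijection.injective s (trans s-y′≡y (sym (s-fix _ y∈A))))) y∈A))

    ψ-fixes-shifted : ∀ {y} → y < N → Ψ.swap (D + y) ≡ D + y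
    ψ-fixes-shifted y<N = Ψ.swap-outside
      (λ _ → <⇒≢shift (ℕₚ.+-monoʳ-< D y<N) ℕₚ.≤-refl)
      (λ (y′<N , _) → <⇒≢shift (s<D _ y′<N) ℕₚ.≤-refl ∘ sym)

    ψτ₁≗τ₁ : ∀ y → y < N → Ψ.swap (Bijection.to τ₁ y) ≡ Bijection.to τ₁ y
    ψτ₁≗τ₁ y y<N with y ∈? A
    ... | yes y∈A = cong-trans Ψ.swap (τ-fixes-A N≤D y<N y∈A)
                      (trans (ψ-fixes-A y<N y∈A) (sym (τ-fixes-A N≤D y<N y∈A)))
    ... | no y∉A = cong-trans Ψ.swap (τ-moved N≤D y<N y∉A)
                      (trans (ψ-fixes-shifted y<N) (sym (τ-moved N≤D y<N y∉A)))

    τ₂τ₁-A : ∀ {y} → y < N → y ∈ₗ A → Bijection.to τ₂ (Bijection.to τ₁ y) ≡ y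
    τ₂τ₁-A y<N y∈A = cong-trans (Bijection.to τ₂) (τ-fixes-A N≤D y<N y∈A)
                             (τ-fixes-A (ℕₚ.≤-refl {N′}) (<-weaken (ℕₚ.m≤n+m N D) y<N) y∈A)

    τ₂τ₁-moved : ∀ {y} → y < N → ¬ (y ∈ₗ A) → Bijection.to τ₂ (Bijection.to τ₁ y) ≡ N′ + (D + y)
    τ₂τ₁-moved {y} y<N y∉A = cong-trans (Bijection.to τ₂) (τ-moved N≤D y<N y∉A)
      (τ-moved (ℕₚ.≤-refl {N′}) {D + y} (ℕₚ.+-monoʳ-< D y<N) (λ D+y∈A → <⇒≢shift (A<N D+y∈A) N≤D refl))

    ψτ₂τ₁≗s : ∀ y → y < N → Ψ.swap (Bijection.to τ₂ (Bijection.to τ₁ y)) ≡ Bijection.to s y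
    ψτ₂τ₁≗s y y<N with y ∈? A
    ... | yes y∈A = cong-trans Ψ.swap (τ₂τ₁-A y<N y∈A) (trans (ψ-fixes-A y<N y∈A) (sym (s-fix y y∈A)))
    ... | no y∉A = cong-trans Ψ.swap (τ₂τ₁-moved y<N y∉A) (Ψ.swap-P (y<N , y∉A))

  -- φ̃ flips by g transported along t and cut off below N.  It is trivial below N, since t
  -- moves every (n-1)-set below N that is not inside A out of [0, N), while its conjugate
  -- by t agrees with the flip by g below N.
  module CutOff {n : ℕ} (N : ℕ) (g : Vec ℕ (pred n) → Bool)
    (g-wd : RespectsSameSet g)
    (g-A : ∀ v → Distinct v → All (_∈ₗ A) v → g v ≡ false)
    where

    t : ℕ ⤖ ℕ
    t = τ (ℕₚ.≤-refl {N})

    φ̃ : Aut n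
    φ̃ = flipAut (restrictBelow N g ∘ map (Bijection.to t)) λ v w dv dw v≈w →
      restrictBelow-wd N g g-wd _ _ (map-distinct t v dv) (map-distinct t w dw)
                       (SameSet-map (Bijection.to t) v≈w)

    stays-below⇒∈A : ∀ {y} → y < N → Bijection.to t y < N → y ∈ₗ A
    stays-below⇒∈A {y} y<N ty<N with y ∈? A
    ... | yes y∈A = y∈A
    ... | no y∉A = ⊥-elim (ℕₚ.<-irrefl refl (ℕₚ.<-≤-trans
                     (subst (_< N) (τ-moved ℕₚ.≤-refl y<N y∉A) ty<N) (ℕₚ.m≤m+n N y)))

    stays-below⇒⊆A : {v : Vec ℕ (pred n)} → All (_< N) v → All (_< N) (map (Bijection.to t) v) →
                     All (λ y → y < N × y ∈ₗ A) v
    stays-below⇒⊆A v<N tv<N =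
      All.map (λ (y<N , ty<N) → y<N , stays-below⇒∈A y<N ty<N) (All.zip (v<N , Allₚ.map⁻ tv<N))

    t-fixes : {v : Vec ℕ (pred n)} → All (λ y → y < N × y ∈ₗ A) v → map (Bijection.to t) v ≡ v
    t-fixes {v} v⊆A =
      trans (map-cong-All v⊆A (λ (y<N , y∈A) → τ-fixes-A ℕₚ.≤-refl y<N y∈A)) (Vecₚ.map-id v)

    φ̃-agrees-id : AgreeBelow N idAut φ̃
    φ̃-agrees-id = record
      { σ-agree = λ _ _ → refl
      ; f-agree = λ v dv v<N → sym (restrictBelow-false N g λ tv<N →
          let v⊆A = stays-below⇒⊆A v<N tv<N
          in trans (cong g (t-fixes v⊆A)) (g-A v dv (All.map proj₂ v⊆A)))
      }

    conjugate-agrees : AgreeBelow N (permAut t ∘ᴬ φ̃ ∘ᴬ permAut t) (flipAut g g-wd)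
    conjugate-agrees = record
      { σ-agree = λ y _ → ShiftSwap.swap-involutive N 0 N ℕₚ.≤-refl y
      ; f-agree = λ v dv v<N → trans (Boolₚ.xor-identityʳ _)
          (trans (cong (restrictBelow N g) (map-t-involutive v)) (restrictBelow-below N g v<N))
      }
      where
      map-t-involutive : (v : Vec ℕ (pred n)) → map (Bijection.to t) (map (Bijection.to t) v) ≡ v
      map-t-involutive v = trans (sym (Vecₚ.map-∘ _ _ v))
        (trans (Vecₚ.map-cong (ShiftSwap.swap-involutive N 0 N ℕₚ.≤-refl) v) (Vecₚ.map-id v))

-- Elements algebraic over a finite A ⊆ Ω

module InvariantEquivalence {n : ℕ} (S : EqSort n) where

  open EqSort S public renaming (k to K)

  E-setoid : Setoid 0ℓ 0ℓ
  E-setoid = record { Carrier = Vec (Pt n) K ; _≈_ = E ; isEquivalence = isEquiv }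

  open Setoid E-setoid public using () renaming (refl to E-refl; sym to E-sym; trans to E-trans)

  ≈T⇒E : {a b : Vec (Pt n) K} → a ≈T b → E a b
  ≈T⇒E {a} {b} a≈b = resp {a} {a} {a} {b} (≈T-refl a) a≈b E-refl

  ·-transport : {N : ℕ} (π s t s′ t′ : ℕ ⤖ ℕ) (c : Vec (Pt n) K) → BelowT N c →
                (∀ y → y < N → Bijection.to π (Bijection.to s y) ≡ Bijection.to s′ y) →
                (∀ y → y < N → Bijection.to π (Bijection.to t y) ≡ Bijection.to t′ y) →
                E (s · c) (t · c) → E (s′ · c) (t′ · c)
  ·-transport π s t s′ t′ c c<N πs≗s′ πt≗t′ sc~tc = begin
    s′ · c          ≈⟨ ≈T⇒E (·-agree s′ (π ⤖-∘ s) (λ y y<N → sym (πs≗s′ y y<N)) c c<N) ⟩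
    (π ⤖-∘ s) · c   ≈⟨ ≈T⇒E (·-∘ π s c) ⟨
    π · s · c       ≈⟨ inv (permAut π) sc~tc ⟩
    π · t · c       ≈⟨ ≈T⇒E (·-∘ π t c) ⟩
    (π ⤖-∘ t) · c   ≈⟨ ≈T⇒E (·-agree (π ⤖-∘ t) t′ πt≗t′ c c<N) ⟩
    t′ · c          ∎
    where open SetoidReasoning E-setoid

module AlgebraicOver {n : ℕ} (A : List ℕ) (S : EqSort n) where

  open Shift A
  open InvariantEquivalence S

  Algebraic : Vec (Pt n) K → Set₁
  Algebraic c = aclΩ A (record { S = S ; a = c })

  FixesA : Aut n → Set
  FixesA h = ∀ x → x ∈ₗ A → Bijection.to (σ h) x ≡ x

  Algebraic-act : {c : Vec (Pt n) K} → Algebraic c → (g : Aut n) → FixesA g → Algebraic (actT g c)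
  Algebraic-act {c} (L , orbit) g g-fix = L , λ h (lift h-fix) →
    Any.map (E-trans (≈T⇒E (actT-∘ h g c)))
            (orbit (h ∘ᴬ g) (lift λ x x∈A → trans (cong (Bijection.to (σ h)) (g-fix x x∈A))
                                                  (h-fix x x∈A)))

  module _ {c : Vec (Pt n) K} {N : ℕ} (c<N : BelowT N c) (A<N : ∀ {x} → x ∈ₗ A → x < N) where

    -- Applying τⱼ gives c ~ τₖ · c; the swap ζ of the copies at D and Dₖ turns τₖ into τ.
    shift-collision : {D Dⱼ Dₖ : ℕ} (N≤D : N ≤ D) (N≤Dⱼ : N ≤ Dⱼ) (N≤Dₖ : N ≤ Dₖ) →
                      D ≤ Dⱼ → Dⱼ + N ≤ Dₖ → E (τ N≤Dⱼ · c) (τ N≤Dₖ · c) → E c (τ N≤D · c)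
    shift-collision {D} {Dⱼ} {Dₖ} N≤D N≤Dⱼ N≤Dₖ D≤Dⱼ Dⱼ+N≤Dₖ τⱼc~τₖc = begin
      c           ≈⟨ ≈T⇒E (actT-id c) ⟨
      ⤖-id ℕ · c  ≈⟨ ·-transport ζ (⤖-id ℕ) (τ N≤Dₖ) (⤖-id ℕ) (τ N≤D) c c<N
                                 (λ y y<N → shiftSwap-fixes-low N D Dₖ D+N≤Dₖ (<-weaken N≤D y<N))
                                 (shiftSwap-τ N≤D N≤Dₖ D+N≤Dₖ) c~τₖc ⟩
      τ N≤D · c   ∎
      where
      open SetoidReasoning E-setoid
      D+N≤Dₖ : D + N ≤ Dₖ
      D+N≤Dₖ = ℕₚ.≤-trans (ℕₚ.+-monoˡ-≤ N D≤Dⱼ) Dⱼ+N≤Dₖ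

      ζ : ℕ ⤖ ℕ
      ζ = ShiftSwap.swap⤖ N D Dₖ D+N≤Dₖ

      c~τₖc : E (⤖-id ℕ · c) (τ N≤Dₖ · c)
      c~τₖc = ·-transport (τ N≤Dⱼ) (τ N≤Dⱼ) (τ N≤Dₖ) (⤖-id ℕ) (τ N≤Dₖ) c c<N
                (λ y _ → ShiftSwap.swap-involutive N 0 Dⱼ N≤Dⱼ y) (τ-fixes-τ N≤Dⱼ N≤Dₖ Dⱼ+N≤Dₖ) τⱼc~τₖc

    -- Of |L| + 1 translates spaced N apart, two land on the same element of the orbit list L.
    shift-invariant : Algebraic c → {D : ℕ} (N≤D : N ≤ D) → E c (τ N≤D · c)
    shift-invariant (L , orbit) {D} N≤D =
      collide (Finₚ.pigeonhole (ℕₚ.n<1+n (length L)) (Any.index ∘ witness))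
      where
      Dₛ : Fin (suc (length L)) → ℕ
      Dₛ j = D + N * toℕ j

      N≤Dₛ : ∀ j → N ≤ Dₛ j
      N≤Dₛ j = ℕₚ.≤-trans N≤D (ℕₚ.m≤m+n D _)

      witness : ∀ j → Any (E (τ (N≤Dₛ j) · c)) L
      witness j = orbit (permAut (τ (N≤Dₛ j))) (lift λ x x∈A → τ-fixes-A (N≤Dₛ j) (A<N x∈A) x∈A)

      collide : (∃₂ λ j k → j Fin.< k × Any.index (witness j) ≡ Any.index (witness k)) →
                E c (τ N≤D · c)
      collide (j , k , j<k , same-slot) =
        shift-collision N≤D (N≤Dₛ j) (N≤Dₛ k) (ℕₚ.m≤m+n D _)
          (translates-spaced D N (toℕ j) (toℕ k) j<k)
          (E-trans (Anyₚ.lookup-index (witness j))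
                   (E-sym (subst (λ i → E _ (Data.List.lookup L i)) (sym same-slot)
                                 (Anyₚ.lookup-index (witness k)))))

  -- ψ fixes τ₁ · c but sends τ₂ τ₁ · c to s · c, and both are ~ c by shift-invariance.
  perm-invariant : {c : Vec (Pt n) K} → Algebraic c → (s : ℕ ⤖ ℕ) →
                   (∀ x → x ∈ₗ A → Bijection.to s x ≡ x) → E c (s · c)
  perm-invariant {c} alg s s-fix with commonBound c A
  ... | N , c<N , A<N with ∃-both (λ N≤M D≤N → ℕₚ.≤-trans D≤N N≤M)
                                 (λ N≤M s<N y y<N → <-weaken N≤M (s<N y y<N))
                                 (N , ℕₚ.≤-refl) (imageBound (Bijection.to s) N)
  ... | D , N≤D , s<D with reroute N≤D A<N s s-fix s<D
  ... | ψ , ψτ₁≗τ₁ , ψτ₂τ₁≗s = begin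
    c         ≈⟨ shift-invariant c<N A<N alg N≤D ⟩
    τ₁ · c    ≈⟨ ·-transport ψ τ₁ (τ₂ ⤖-∘ τ₁) τ₁ s c c<N ψτ₁≗τ₁ ψτ₂τ₁≗s τ₁c~τ₂τ₁c ⟩
    s · c     ∎
    where
    open SetoidReasoning E-setoid
    τ₁ = τ N≤D
    τ₂ = τ (ℕₚ.≤-refl {D + N})

    τ₁-below : ∀ y → y < N → Bijection.to τ₁ y < D + N
    τ₁-below y y<N with y ∈? A
    ... | yes y∈A = subst (_< D + N) (sym (τ-fixes-A N≤D y<N y∈A)) (<-weaken (ℕₚ.m≤n+m N D) y<N)
    ... | no y∉A = subst (_< D + N) (sym (τ-moved N≤D y<N y∉A)) (ℕₚ.+-monoʳ-< D y<N)

    τ₁c~τ₂τ₁c : E (τ₁ · c) ((τ₂ ⤖-∘ τ₁) · c)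
    τ₁c~τ₂τ₁c = E-trans
      (shift-invariant (actT-below (permAut τ₁) τ₁-below c c<N)
                       (λ x∈A → <-weaken (ℕₚ.m≤n+m N D) (A<N x∈A))
                       (Algebraic-act alg (permAut τ₁) (λ x x∈A → τ-fixes-A N≤D (A<N x∈A) x∈A))
                       (ℕₚ.≤-refl {D + N}))
      (≈T⇒E (·-∘ τ₂ τ₁ c))

  flip-invariant : {c : Vec (Pt n) K} → Algebraic c → (g : Vec ℕ (pred n) → Bool) →
                   (g-wd : RespectsSameSet g) →
                   (∀ v → Distinct v → All (_∈ₗ A) v → g v ≡ false) →
                   E c (actT (flipAut g g-wd) c)
  flip-invariant {c} alg g g-wd g-A with commonBound c A
  ... | N , c<N , A<N = begin
    c                                    ≈⟨ c~tc ⟩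
    t · c                                ≈⟨ inv (permAut t) c~φ̃tc ⟩
    t · actT (φ̃ ∘ᴬ permAut t) c          ≈⟨ ≈T⇒E (actT-∘ (permAut t) (φ̃ ∘ᴬ permAut t) c) ⟩
    actT (permAut t ∘ᴬ φ̃ ∘ᴬ permAut t) c  ≈⟨ ≈T⇒E (actT-agree _ _ conjugate-agrees c c<N) ⟩
    actT (flipAut g g-wd) c              ∎
    where
    open SetoidReasoning E-setoid
    open CutOff {n} N g g-wd g-A
    c~tc = shift-invariant c<N A<N alg ℕₚ.≤-refl

    c~φ̃tc : E c (actT (φ̃ ∘ᴬ permAut t) c)
    c~φ̃tc = begin
      c                        ≈⟨ ≈T⇒E (actT-id c) ⟨
      actT idAut c             ≈⟨ ≈T⇒E (actT-agree idAut φ̃ φ̃-agrees-id c c<N) ⟩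
      actT φ̃ c                 ≈⟨ inv φ̃ c~tc ⟩
      actT φ̃ (t · c)           ≈⟨ ≈T⇒E (actT-∘ φ̃ (permAut t) c) ⟩
      actT (φ̃ ∘ᴬ permAut t) c  ∎

  algebraic-fixed : {c : Vec (Pt n) K} → Algebraic c → (h : Aut n) → FixesA h →
                    (∀ v → Distinct v → All (_∈ₗ A) v → f h v ≡ false) → E (actT h c) c
  algebraic-fixed {c} alg h h-fix f-A with tupleBound c
  ... | N , c<N = begin
    actT h c                        ≈⟨ ≈T⇒E (actT-agree h (permAut (σ h) ∘ᴬ φ) split c c<N) ⟩
    actT (permAut (σ h) ∘ᴬ φ) c     ≈⟨ ≈T⇒E (actT-∘ (permAut (σ h)) φ c) ⟨
    σ h · actT φ c                  ≈⟨ perm-invariant (Algebraic-act alg φ (λ _ _ → refl)) (σ h) h-fix ⟨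
    actT φ c                        ≈⟨ flip-invariant alg (f h) (f-wd h) f-A ⟨
    c                               ∎
    where
    open SetoidReasoning E-setoid
    φ = flipAut (f h) (f-wd h)
    split : AgreeBelow N h (permAut (σ h) ∘ᴬ φ)
    split = record { σ-agree = λ _ _ → refl ; f-agree = λ v _ _ → sym (Boolₚ.xor-identityʳ (f h v)) }

-- The home sort Ω and the finitely many corrections

module _ {n : ℕ} where

  ω-value : Pt n → Maybe ℕ
  ω-value (elt x) = just x
  ω-value (sub _ _) = nothing
  ω-value (fib _ _ _) = nothing

  ω-value-≈ : {p q : Pt n} → p ≈P q → ω-value p ≡ ω-value q
  ω-value-≈ elt≈ = refl
  ω-value-≈ (sub≈ _) = refl
  ω-value-≈ (fib≈ _) = refl

  ω-value-act : (h : Aut n) (p : Pt n) → ω-value (actP h p) ≡ Maybe.map (Bijection.to (σ h)) (ω-value p)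
  ω-value-act h (elt x) = refl
  ω-value-act h (sub _ _) = refl
  ω-value-act h (fib _ _ _) = refl

  ΩSort : EqSort n
  ΩSort = record
    { k = 1
    ; E = λ a b → ω-value (lookup a zero) ≡ ω-value (lookup b zero)
    ; isEquiv = record { refl = refl ; sym = sym ; trans = trans }
    ; resp = λ a≈a′ b≈b′ eq → trans (sym (ω-value-≈ (a≈a′ zero))) (trans eq (ω-value-≈ (b≈b′ zero)))
    ; inv = λ { h {p ∷ []} {q ∷ []} eq →
        trans (ω-value-act h p) (trans (cong (Maybe.map _) eq) (sym (ω-value-act h q))) }
    }

  ω : ℕ → Imag n
  ω x = record { S = ΩSort ; a = elt x ∷ [] }

  ω-algebraic : {A : List ℕ} {x : ℕ} → x ∈ₗ A → aclΩ A (ω x)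
  ω-algebraic x∈A = (elt _ ∷ []) ∷ [] , λ _ (lift h-fix) → here (cong just (h-fix _ x∈A))

  ω-fixed : (h : Aut n) {x : ℕ} → Fixes h (ω x) → Bijection.to (σ h) x ≡ x
  ω-fixed h = Maybeₚ.just-injective

∈-⋃⁺ : {n : ℕ} (A : Fin n → List ℕ) {i : Fin n} {x : ℕ} → x ∈ₗ A i → x ∈ₗ ⋃ A
∈-⋃⁺ A {i} x∈Aᵢ = List∈ₚ.∈-concat⁺′ x∈Aᵢ (List∈ₚ.∈-tabulate⁺ i)

∈-⋃⁻ : {n : ℕ} (A : Fin n → List ℕ) {x : ℕ} → x ∈ₗ ⋃ A → ∃ λ i → x ∈ₗ A i
∈-⋃⁻ A x∈⋃A with List∈ₚ.∈-concat⁻′ (Data.List.tabulate A) x∈⋃A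
... | _ , x∈B , B∈A with List∈ₚ.∈-tabulate⁻ B∈A
...   | i , refl = i , x∈B

Distinct? : {k : ℕ} (u : Vec ℕ k) → Dec (Distinct u)
Distinct? u = Finₚ.all? λ i → Finₚ.all? λ j → (lookup u i ≟ lookup u j) →-dec (i Finₚ.≟ j)

SameSet? : {k : ℕ} (u v : Vec ℕ k) → Dec (SameSet u v)
SameSet? u v = Dec.map′ (λ (u⊆v , v⊆u) x → All.lookup u⊆v , All.lookup v⊆u)
                        (λ u≈v → All-∈ u (proj₁ (u≈v _)) , All-∈ v (proj₂ (u≈v _)))
                        (All.all? (Vec∈?._∈? v) u ×-dec All.all? (Vec∈?._∈? u) v)

Matches : {k : ℕ} → Vec ℕ k → Vec ℕ k → Set
Matches u v = Distinct u × SameSet u v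

-- Opaque so that `with matches? u v` abstracts it in goals.
opaque
  matches? : {k : ℕ} (u v : Vec ℕ k) → Dec (Matches u v)
  matches? u v = Distinct? u ×-dec SameSet? u v

Table : ℕ → Set
Table k = List (Vec ℕ k × Bool)

lookupSet : {k : ℕ} → Table k → Vec ℕ k → Bool
lookupSet [] v = false
lookupSet ((u , b) ∷ t) v = if does (matches? u v) then b else lookupSet t v

lookupSet-wd : {k : ℕ} (t : Table k) → RespectsSameSet (lookupSet t)
lookupSet-wd [] v w dv dw v≈w = refl
lookupSet-wd ((u , b) ∷ t) v w dv dw v≈w =
  cong₂ (λ match rest → if match then b else rest)
        (does-⇔ (mk⇔ (λ (du , u≈v) → du , SameSet-trans u≈v v≈w)
                     (λ (du , u≈w) → du , SameSet-trans u≈w (SameSet-sym v≈w)))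
                (matches? u v) (matches? u w))
        (lookupSet-wd t v w dv dw v≈w)

graph : {k : ℕ} → (Vec ℕ k → Bool) → List (Vec ℕ k) → Table k
graph g = Data.List.map λ u → u , g u

lookupSet-graph : {k : ℕ} (g : Vec ℕ k → Bool) → RespectsSameSet g → (V : List (Vec ℕ k)) →
                  {v : Vec ℕ k} → Distinct v → v ∈ₗ V → lookupSet (graph g V) v ≡ g v
lookupSet-graph g g-wd (u ∷ V) {v} dv v∈V with matches? u v
... | yes (du , u≈v) = g-wd u v du dv u≈v
... | no no-match with v∈V
...   | here refl = contradiction (dv , SameSet-refl v) no-match
...   | there v∈V′ = lookupSet-graph g g-wd V dv v∈V′

tables : {k : ℕ} → List (Vec ℕ k) → List (Table k)
tables [] = [] ∷ []
tables (u ∷ V) = cartesianProductWith (λ b t → (u , b) ∷ t) (true ∷ false ∷ []) (tables V)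

graph∈tables : {k : ℕ} (g : Vec ℕ k → Bool) (V : List (Vec ℕ k)) → graph g V ∈ₗ tables V
graph∈tables g [] = here refl
graph∈tables g (u ∷ V) =
  Anyₚ.cartesianProductWith⁺ (λ b t → (u , b) ∷ t) (λ { refl refl → refl })
                             (bool∈ (g u)) (graph∈tables g V)
  where
  bool∈ : (b : Bool) → b ∈ₗ true ∷ false ∷ []
  bool∈ true = here refl
  bool∈ false = there (here refl)

vectorsOver : (k : ℕ) → List ℕ → List (Vec ℕ k)
vectorsOver zero U = [] ∷ []
vectorsOver (suc k) U = cartesianProductWith _∷_ U (vectorsOver k U)

vectorsOver-complete : {k : ℕ} {U : List ℕ} {v : Vec ℕ k} → All (_∈ₗ U) v → v ∈ₗ vectorsOver k U
vectorsOver-complete [] = here refl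
vectorsOver-complete (x∈U ∷ v⊆U) =
  Anyₚ.cartesianProductWith⁺ _∷_ (λ { refl refl → refl }) x∈U (vectorsOver-complete v⊆U)

module _ {n : ℕ} where

  correction : Table (pred n) → Aut n
  correction t = flipAut (lookupSet t) (lookupSet-wd t)

  correction-cancel : {k : ℕ} (t : Table (pred n)) (h : Aut n) (a : Vec (Pt n) k) →
                      actT (correction t) (actT (correction t ∘ᴬ h) a) ≈T actT h a
  correction-cancel t h a with tupleBound a
  ... | N , a<N = begin
    actT (correction t) (actT (correction t ∘ᴬ h) a)  ≈⟨ actT-∘ (correction t) (correction t ∘ᴬ h) a ⟩
    actT (correction t ∘ᴬ correction t ∘ᴬ h) a        ≈⟨ actT-agree _ h cancels a a<N ⟩
    actT h a                                          ∎
    where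
    open ≈T-Reasoning
    cancels : AgreeBelow N (correction t ∘ᴬ correction t ∘ᴬ h) h
    cancels = record { σ-agree = λ _ _ → refl
                     ; f-agree = λ v _ _ → xor-cancelʳ (f h v) _ }

  corrected-stabilises : (A : Fin n → List ℕ) (h : Aut n) →
                         (∀ x → x ∈ₗ ⋃ A → Bijection.to (σ h) x ≡ x) →
                         (e : Imag n) → ⋃acl A e →
                         Fixes (correction (graph (f h) (vectorsOver (pred n) (⋃ A))) ∘ᴬ h) e
  corrected-stabilises A h h-fix e (i , alg) =
    AlgebraicOver.algebraic-fixed (A i) (Imag.S e) alg _ (λ x x∈Aᵢ → h-fix x (∈-⋃⁺ A x∈Aᵢ)) vanishes
    where
    vanishes : ∀ v → Distinct v → All (_∈ₗ A i) v →
               f h v xor lookupSet (graph (f h) (vectorsOver (pred n) (⋃ A))) (map (Bijection.to (σ h)) v)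
               ≡ false
    vanishes v dv v⊆Aᵢ = begin
      f h v xor lookupSet (graph (f h) V) (map (Bijection.to (σ h)) v)
        ≡⟨ cong (λ w → f h v xor lookupSet (graph (f h) V) w)
                (trans (map-cong-All v⊆Aᵢ (h-fix _ ∘ ∈-⋃⁺ A)) (Vecₚ.map-id v)) ⟩
      f h v xor lookupSet (graph (f h) V) v
        ≡⟨ cong (f h v xor_) (lookupSet-graph (f h) (f-wd h) V dv
                               (vectorsOver-complete (All.map (∈-⋃⁺ A) v⊆Aᵢ))) ⟩
      f h v xor f h v
        ≡⟨ Boolₚ.xor-same (f h v) ⟩
      false ∎
      where
      open ≡-Reasoning
      V = vectorsOver (pred n) (⋃ A)

  aclΩ-⋃⇒acl-⋃acl : (A : Fin n → List ℕ) (e : Imag n) → aclΩ (⋃ A) e → acl (⋃acl A) e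
  aclΩ-⋃⇒acl-⋃acl A e (L , orbit) = L , λ h h-fixes → orbit h (lift λ x x∈⋃A →
    let i , x∈Aᵢ = ∈-⋃⁻ A x∈⋃A in ω-fixed h (h-fixes (ω x) (i , ω-algebraic x∈Aᵢ)))

  -- correction t ∘ᴬ h lies in the stabiliser of ⋃acl A, where t is the table of f h on the
  -- finitely many (n-1)-tuples from ⋃ A.
  acl-⋃acl⇒aclΩ-⋃ : (A : Fin n → List ℕ) (e : Imag n) → acl (⋃acl A) e → aclΩ (⋃ A) e
  acl-⋃acl⇒aclΩ-⋃ A e (L , orbit) =
    cartesianProductWith (λ t → actT (correction t)) (tables V) L , covered
    where
    open InvariantEquivalence (Imag.S e)
    V = vectorsOver (pred n) (⋃ A)
    a = Imag.a e

    covered : (h : Aut n) → Lift _ (∀ x → x ∈ₗ ⋃ A → Bijection.to (σ h) x ≡ x) →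
              Any (E (actT h a)) (cartesianProductWith (λ t → actT (correction t)) (tables V) L)
    covered h (lift h-fix) =
      Anyₚ.cartesianProductWith⁺ (λ t → actT (correction t))
        (λ { refl h′a~l → E-trans (E-sym (≈T⇒E (correction-cancel t h a))) (inv (correction t) h′a~l) })
        (graph∈tables (f h) V)
        (orbit (correction t ∘ᴬ h) (corrected-stabilises A h h-fix))
      where t = graph (f h) V

proposition4p10 : (n : ℕ) → 2 ≤ n → (A : Fin n → List ℕ) → (e : Imag n) →
    acl (⋃acl A) e ⇔ aclΩ (⋃ A) e
proposition4p10 n _ A e = mk⇔ (acl-⋃acl⇒aclΩ-⋃ A e) (aclΩ-⋃⇒acl-⋃acl A e)
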